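{- Let $n$ be a non-negative integer. If $\{(s_k),(\sigma_k)\}$ and $\{(t_k),(\tau_k)\}$, $k=0,1,2,\ldots$, are binomial-transform pairs of the first kind, then \[ \sum_{k=1}^n(-1)^{n-k-1}\binom nk s_{k-1}t_{n-k}=\sum_{k=1}^n(-1)^k\binom nk\tau_{n-k}\sum_{j=1}^k\sigma_{j-1}. \]
   Context: Two sequences $(s_k)_{k\ge0}$ and $(\sigma_k)_{k\ge0}$ of complex numbers form a binomial-transform pair of the first kind if $\sigma_n=\sum_{k=0}^n(-1)^k\binom nk s_k$ for every non-negative integer $n$. -}

module Defs where

open import Level using (Level)
open import Algebra.Bundles using (CommutativeRing)
open import Data.Nat using (ℕ; zero; suc; _∸_)
open import Data.Nat.Combinatorics using (_C_)

module _ {c ℓ : Level} (R : CommutativeRing c ℓ) where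
  open CommutativeRing R hiding (zero)

  ι : ℕ → Carrier
  ι zero    = 0#
  ι (suc n) = 1# + ι n

  neg1^ : ℕ → Carrier
  neg1^ zero    = 1#
  neg1^ (suc k) = (- 1#) * neg1^ k

  ∑0 : ℕ → (ℕ → Carrier) → Carrier
  ∑0 zero    f = f zero
  ∑0 (suc n) f = ∑0 n f + f (suc n)

  ∑1 : ℕ → (ℕ → Carrier) → Carrier
  ∑1 zero    f = 0#
  ∑1 (suc n) f = ∑1 n f + f (suc n)

  binom : ℕ → ℕ → Carrier
  binom n k = ι (n C k)

  IsBinomialPair : (ℕ → Carrier) → (ℕ → Carrier) → Set ℓ
  IsBinomialPair s σ = ∀ n → σ n ≈ ∑0 n (λ k → neg1^ k * (binom n k * s k))

-- Write (T a)ₙ = ∑ₖ (-1)ᵏ C(n,k) aₖ for the binomial transform, alt a for (-1)ᵏ aₖ and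
-- (f ⋆ g)ₙ = ∑ₖ C(n,k) fₖ g₍ₙ₋ₖ₎ for the binomial convolution.  On exponential generating
-- functions T sends A(x) to eˣ A(-x), so alt (T a) ⋆ T b has generating function
-- e⁻ˣA(x) · eˣB(-x) = A(x) B(-x), i.e. alt (T a) ⋆ T b = a ⋆ alt b.  This identity is proved by
-- induction on n, generalising a and b, from the Leibniz rule
-- (f ⋆ g)ₙ₊₁ = (f ⋆ shift g)ₙ + (shift f ⋆ g)ₙ and the difference rule
-- (T a)ₙ₊₁ = (T a)ₙ - (T (shift a))ₙ.  The theorem is its instance a = (0, -s₀, -s₁, …), b = t:
-- the transform of that a is the sequence of partial sums of σ.
{-# OPTIONS --safe #-}
module Submission where

open import Defs
open import Level using (Level)
open import Algebra.Bundles using (CommutativeRing)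
open import Data.Nat.Base as Nat using (ℕ; zero; suc; _∸_; _≤_; z≤n)
open import Data.Nat.Properties using (m≤n⇒m≤1+n; ≤-refl; n<1+n; +-∸-assoc)
open import Data.Nat.Combinatorics using (_C_; nCk+nC[k+1]≡[n+1]C[k+1])
open import Data.Nat.Combinatorics.Specification using (k>n⇒nCk≡0)
import Relation.Binary.PropositionalEquality as ≡
import Algebra.Properties.Ring as RingProperties
import Algebra.Properties.AbelianGroup as AbelianGroupProperties
import Algebra.Properties.CommutativeSemigroup as CommutativeSemigroupProperties
import Relation.Binary.Reasoning.Setoid as SetoidReasoning

module BinomialConvolution {c ℓ : Level} (R : CommutativeRing c ℓ) where
  open CommutativeRing R hiding (zero)
  open RingProperties ring using (-‿distribˡ-*; -‿distribʳ-*; -1*x≈-x; x[y-z]≈xy-xz; [y-z]x≈yx-zx)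
  open AbelianGroupProperties +-abelianGroup using (⁻¹-involutive; ⁻¹-∙-comm; ⁻¹-anti-homo‿-)
  open CommutativeSemigroupProperties *-commutativeSemigroup using (x∙yz≈y∙xz; xy∙z≈x∙zy)
  open CommutativeSemigroupProperties +-commutativeSemigroup using () renaming (interchange to +-interchange)
  open SetoidReasoning setoid

  Seq : Set c
  Seq = ℕ → Carrier

  x*[y*-z]≈-[x*[y*z]] : ∀ x y z → x * (y * - z) ≈ - (x * (y * z))
  x*[y*-z]≈-[x*[y*z]] x y z = trans (*-congˡ (sym (-‿distribʳ-* y z))) (sym (-‿distribʳ-* x _))

  -[x*[y-z]]≈xz-xy : ∀ x y z → - (x * (y - z)) ≈ x * z - x * y
  -[x*[y-z]]≈xz-xy x y z = begin
    - (x * (y - z))  ≈⟨ -‿distribʳ-* x _ ⟩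
    x * - (y - z)    ≈⟨ *-congˡ (⁻¹-anti-homo‿- y z) ⟩
    x * (z - y)      ≈⟨ x[y-z]≈xy-xz x z y ⟩
    x * z - x * y    ∎

  -x*[w*[y*z]]≈w*[-y*[x*z]] : ∀ w x y z → - x * (w * (y * z)) ≈ w * (- y * (x * z))
  -x*[w*[y*z]]≈w*[-y*[x*z]] w x y z = begin
    - x * (w * (y * z))      ≈⟨ -‿distribˡ-* x _ ⟨
    - (x * (w * (y * z)))    ≈⟨ -‿cong (x∙yz≈y∙xz x w _) ⟩
    - (w * (x * (y * z)))    ≈⟨ -‿cong (*-congˡ (x∙yz≈y∙xz x y z)) ⟩
    - (w * (y * (x * z)))    ≈⟨ -‿distribʳ-* w _ ⟩
    w * - (y * (x * z))      ≈⟨ *-congˡ (-‿distribˡ-* y _) ⟩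
    w * (- y * (x * z))      ∎

  w*[xy*z]≈x*[w*[zy]] : ∀ w x y z → w * ((x * y) * z) ≈ x * (w * (z * y))
  w*[xy*z]≈x*[w*[zy]] w x y z = trans (*-congˡ (xy∙z≈x∙zy x y z)) (x∙yz≈y∙xz w x _)

  [x-y]+[z-x]≈z-y : ∀ x y z → (x - y) + (z - x) ≈ z - y
  [x-y]+[z-x]≈z-y x y z = begin
    (x - y) + (z - x)    ≈⟨ +-comm _ _ ⟩
    (z - x) + (x - y)    ≈⟨ +-assoc z (- x) _ ⟩
    z + (- x + (x - y))  ≈⟨ +-congˡ (sym (+-assoc (- x) x _)) ⟩
    z + ((- x + x) - y)  ≈⟨ +-congˡ (+-congʳ (-‿inverseˡ x)) ⟩
    z + (0# - y)         ≈⟨ +-congˡ (+-identityˡ _) ⟩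
    z - y                ∎

  ∑0-cong-≤ : ∀ n {f g : Seq} → (∀ k → k ≤ n → f k ≈ g k) → ∑0 R n f ≈ ∑0 R n g
  ∑0-cong-≤ zero    f≈g = f≈g 0 z≤n
  ∑0-cong-≤ (suc n) f≈g = +-cong (∑0-cong-≤ n (λ k k≤n → f≈g k (m≤n⇒m≤1+n k≤n))) (f≈g (suc n) ≤-refl)

  ∑0-cong : ∀ n {f g : Seq} → (∀ k → f k ≈ g k) → ∑0 R n f ≈ ∑0 R n g
  ∑0-cong n f≈g = ∑0-cong-≤ n (λ k _ → f≈g k)

  ∑1-cong : ∀ n {f g : Seq} → (∀ k → f (suc k) ≈ g (suc k)) → ∑1 R n f ≈ ∑1 R n g
  ∑1-cong zero    f≈g = refl
  ∑1-cong (suc n) f≈g = +-cong (∑1-cong n f≈g) (f≈g n)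

  ∑0-distrib-+ : ∀ n (f g : Seq) → ∑0 R n (λ k → f k + g k) ≈ ∑0 R n f + ∑0 R n g
  ∑0-distrib-+ zero    f g = refl
  ∑0-distrib-+ (suc n) f g = trans (+-congʳ (∑0-distrib-+ n f g)) (+-interchange _ _ _ _)

  ∑0-neg : ∀ n (f : Seq) → ∑0 R n (λ k → - f k) ≈ - ∑0 R n f
  ∑0-neg zero    f = refl
  ∑0-neg (suc n) f = trans (+-congʳ (∑0-neg n f)) (⁻¹-∙-comm _ _)

  ∑0-distrib-- : ∀ n (f g : Seq) → ∑0 R n (λ k → f k - g k) ≈ ∑0 R n f - ∑0 R n g
  ∑0-distrib-- n f g = trans (∑0-distrib-+ n f (λ k → - g k)) (+-congˡ (∑0-neg n g))

  ∑0-shift : ∀ n (f : Seq) → ∑0 R (suc n) f ≈ f 0 + ∑0 R n (λ k → f (suc k))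
  ∑0-shift zero    f = refl
  ∑0-shift (suc n) f = trans (+-congʳ (∑0-shift n f)) (+-assoc _ _ _)

  ∑0≈∑1 : ∀ n {f : Seq} → f 0 ≈ 0# → ∑0 R n f ≈ ∑1 R n f
  ∑0≈∑1 zero    f0≈0 = f0≈0
  ∑0≈∑1 (suc n) f0≈0 = +-congʳ (∑0≈∑1 n f0≈0)

  ι-+ : ∀ m n → ι R (m Nat.+ n) ≈ ι R m + ι R n
  ι-+ zero    n = sym (+-identityˡ _)
  ι-+ (suc m) n = trans (+-congˡ (ι-+ m n)) (sym (+-assoc _ _ _))

  binom-0 : ∀ n → binom R n 0 ≈ 1#
  binom-0 n = +-identityʳ 1#

  binom-n-1+n : ∀ n → binom R n (suc n) ≈ 0#
  binom-n-1+n n = reflexive (≡.cong (ι R) (k>n⇒nCk≡0 (n<1+n n)))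

  binom-pascal : ∀ n k → binom R (suc n) (suc k) ≈ binom R n k + binom R n (suc k)
  binom-pascal n k = trans (reflexive (≡.cong (ι R) (≡.sym (nCk+nC[k+1]≡[n+1]C[k+1] n k))))
                           (ι-+ (n C k) (n C suc k))

  ∑0-binom-head : ∀ n (h : Seq) →
    ∑0 R n (λ k → binom R n k * h k) ≈ h 0 + ∑0 R n (λ k → binom R n (suc k) * h (suc k))
  ∑0-binom-head n h = begin
    ∑0 R n f                              ≈⟨ sym (+-identityʳ _) ⟩
    ∑0 R n f + 0#                         ≈⟨ +-congˡ (sym (trans (*-congʳ (binom-n-1+n n)) (zeroˡ _))) ⟩
    ∑0 R (suc n) f                        ≈⟨ ∑0-shift n f ⟩
    f 0 + ∑0 R n (λ k → f (suc k))        ≈⟨ +-congʳ (trans (*-congʳ (binom-0 n)) (*-identityˡ _)) ⟩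
    h 0 + ∑0 R n (λ k → f (suc k))        ∎
    where
    f : Seq
    f k = binom R n k * h k

  ∑0-pascal : ∀ n (h : Seq) →
    ∑0 R (suc n) (λ k → binom R (suc n) k * h k)
      ≈ ∑0 R n (λ k → binom R n k * h k) + ∑0 R n (λ k → binom R n k * h (suc k))
  ∑0-pascal n h = begin
    ∑0 R (suc n) (λ k → binom R (suc n) k * h k)
      ≈⟨ ∑0-shift n _ ⟩
    binom R (suc n) 0 * h 0 + ∑0 R n (λ k → binom R (suc n) (suc k) * h (suc k))
      ≈⟨ +-cong (trans (*-congʳ (binom-0 (suc n))) (*-identityˡ _))
                (∑0-cong n (λ k → trans (*-congʳ (binom-pascal n k)) (distribʳ _ _ _))) ⟩
    h 0 + ∑0 R n (λ k → lower k + upper k)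
      ≈⟨ +-congˡ (trans (∑0-distrib-+ n lower upper) (+-comm _ _)) ⟩
    h 0 + (∑0 R n upper + ∑0 R n lower)
      ≈⟨ sym (+-assoc _ _ _) ⟩
    (h 0 + ∑0 R n upper) + ∑0 R n lower
      ≈⟨ +-congʳ (sym (∑0-binom-head n h)) ⟩
    ∑0 R n (λ k → binom R n k * h k) + ∑0 R n lower
      ∎
    where
    lower upper : Seq
    lower k = binom R n k * h (suc k)
    upper k = binom R n (suc k) * h (suc k)

  shift : Seq → Seq
  shift a k = a (suc k)

  _∷_ : Carrier → Seq → Seq
  (x ∷ a) zero    = x
  (x ∷ a) (suc k) = a k

  alt : Seq → Seq
  alt a k = neg1^ R k * a k

  transform : Seq → Seq
  transform a n = ∑0 R n (λ k → binom R n k * alt a k)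

  _⋆_ : Seq → Seq → Seq
  (f ⋆ g) n = ∑0 R n (λ k → binom R n k * (f k * g (n ∸ k)))

  alt-suc : ∀ a k → alt a (suc k) ≈ - alt (shift a) k
  alt-suc a k = trans (*-congʳ (-1*x≈-x _)) (sym (-‿distribˡ-* _ _))

  IsBinomialPair⇒≈transform : ∀ {s σ} → IsBinomialPair R s σ → ∀ n → σ n ≈ transform s n
  IsBinomialPair⇒≈transform pair n = trans (pair n) (∑0-cong n (λ k → x∙yz≈y∙xz _ _ _))

  transform-0 : ∀ a → transform a 0 ≈ a 0
  transform-0 a = trans (*-congʳ (binom-0 0)) (trans (*-identityˡ _) (*-identityˡ _))

  transform-suc : ∀ a n → transform a (suc n) ≈ transform a n - transform (shift a) n
  transform-suc a n = begin
    transform a (suc n)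
      ≈⟨ ∑0-pascal n (alt a) ⟩
    transform a n + ∑0 R n (λ k → binom R n k * alt a (suc k))
      ≈⟨ +-congˡ (∑0-cong n (λ k → *-congˡ (alt-suc a k))) ⟩
    transform a n + ∑0 R n (λ k → binom R n k * - alt (shift a) k)
      ≈⟨ +-congˡ (trans (∑0-cong n (λ k → sym (-‿distribʳ-* _ _))) (∑0-neg n _)) ⟩
    transform a n - transform (shift a) n
      ∎

  transform-neg : ∀ a n → transform (λ k → - a k) n ≈ - transform a n
  transform-neg a n = trans (∑0-cong n (λ k → x*[y*-z]≈-[x*[y*z]] _ _ _)) (∑0-neg n _)

  transform-partialSums : ∀ s k → transform (0# ∷ λ j → - s j) k ≈ ∑1 R k (λ j → transform s (j ∸ 1))
  transform-partialSums s zero    = transform-0 (0# ∷ λ j → - s j)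
  transform-partialSums s (suc k) = begin
    transform (0# ∷ λ j → - s j) (suc k)
      ≈⟨ transform-suc (0# ∷ λ j → - s j) k ⟩
    transform (0# ∷ λ j → - s j) k - transform (λ j → - s j) k
      ≈⟨ +-cong (transform-partialSums s k) (-‿cong (transform-neg s k)) ⟩
    ∑1 R k (λ j → transform s (j ∸ 1)) - - transform s k
      ≈⟨ +-congˡ (⁻¹-involutive _) ⟩
    ∑1 R (suc k) (λ j → transform s (j ∸ 1))
      ∎

  ⋆-congˡ : ∀ {f f′} → (∀ k → f k ≈ f′ k) → ∀ g n → (f ⋆ g) n ≈ (f′ ⋆ g) n
  ⋆-congˡ f≈f′ g n = ∑0-cong n (λ k → *-congˡ (*-congʳ (f≈f′ k)))

  ⋆-congʳ : ∀ f {g g′} → (∀ k → g k ≈ g′ k) → ∀ n → (f ⋆ g) n ≈ (f ⋆ g′) n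
  ⋆-congʳ f g≈g′ n = ∑0-cong n (λ k → *-congˡ (*-congˡ (g≈g′ (n ∸ k))))

  ⋆-suc : ∀ f g n → (f ⋆ g) (suc n) ≈ (f ⋆ shift g) n + (shift f ⋆ g) n
  ⋆-suc f g n = trans (∑0-pascal n (λ k → f k * g (suc n ∸ k)))
    (+-congʳ (∑0-cong-≤ n (λ k k≤n → reflexive
      (≡.cong (λ m → binom R n k * (f k * g m)) (+-∸-assoc 1 k≤n)))))

  ⋆-distribʳ-- : ∀ f f′ g n → ((λ k → f k - f′ k) ⋆ g) n ≈ (f ⋆ g) n - (f′ ⋆ g) n
  ⋆-distribʳ-- f f′ g n = trans
    (∑0-cong n (λ k → trans (*-congˡ ([y-z]x≈yx-zx _ _ _)) (x[y-z]≈xy-xz _ _ _)))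
    (∑0-distrib-- n _ _)

  ⋆-distribˡ-- : ∀ f g g′ n → (f ⋆ (λ k → g k - g′ k)) n ≈ (f ⋆ g) n - (f ⋆ g′) n
  ⋆-distribˡ-- f g g′ n = trans
    (∑0-cong n (λ k → trans (*-congˡ (x[y-z]≈xy-xz _ _ _)) (x[y-z]≈xy-xz _ _ _)))
    (∑0-distrib-- n _ _)

  ⋆-negʳ : ∀ f g n → (f ⋆ (λ k → - g k)) n ≈ - (f ⋆ g) n
  ⋆-negʳ f g n = trans (∑0-cong n (λ k → x*[y*-z]≈-[x*[y*z]] _ _ _)) (∑0-neg n _)

  ⋆≈∑1 : ∀ {f} g n → f 0 ≈ 0# → (f ⋆ g) n ≈ ∑1 R n (λ k → binom R n k * (f k * g (n ∸ k)))
  ⋆≈∑1 g n f0≈0 = ∑0≈∑1 n (trans (*-congˡ (trans (*-congʳ f0≈0) (zeroˡ _))) (zeroʳ _))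

  alt-transform-suc : ∀ a k → alt (transform a) (suc k) ≈ alt (transform (shift a)) k - alt (transform a) k
  alt-transform-suc a k = trans (alt-suc (transform a) k)
    (trans (-‿cong (*-congˡ (transform-suc a k))) (-[x*[y-z]]≈xz-xy _ _ _))

  alt-transform-⋆-transform : ∀ n a b → (alt (transform a) ⋆ transform b) n ≈ (a ⋆ alt b) n
  alt-transform-⋆-transform zero a b =
    *-congˡ (*-cong (trans (*-identityˡ _) (transform-0 a)) (trans (transform-0 b) (sym (*-identityˡ _))))
  alt-transform-⋆-transform (suc n) a b = begin
    (alt (transform a) ⋆ transform b) (suc n)
      ≈⟨ ⋆-suc (alt (transform a)) (transform b) n ⟩
    (alt (transform a) ⋆ shift (transform b)) n + (shift (alt (transform a)) ⋆ transform b) n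
      ≈⟨ +-cong shift-right shift-left ⟩
    (P a b - P a (shift b)) + (P (shift a) b - P a b)
      ≈⟨ [x-y]+[z-x]≈z-y _ _ _ ⟩
    P (shift a) b - P a (shift b)
      ≈⟨ +-cong (alt-transform-⋆-transform n (shift a) b) (-‿cong (alt-transform-⋆-transform n a (shift b))) ⟩
    (shift a ⋆ alt b) n - (a ⋆ alt (shift b)) n
      ≈⟨ +-comm _ _ ⟩
    - (a ⋆ alt (shift b)) n + (shift a ⋆ alt b) n
      ≈⟨ +-congʳ (sym shift-alt) ⟩
    (a ⋆ shift (alt b)) n + (shift a ⋆ alt b) n
      ≈⟨ sym (⋆-suc a (alt b) n) ⟩
    (a ⋆ alt b) (suc n)
      ∎
    where
    P : Seq → Seq → Carrier
    P a b = (alt (transform a) ⋆ transform b) n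

    shift-right : (alt (transform a) ⋆ shift (transform b)) n ≈ P a b - P a (shift b)
    shift-right = trans (⋆-congʳ (alt (transform a)) (transform-suc b) n)
                        (⋆-distribˡ-- (alt (transform a)) (transform b) (transform (shift b)) n)

    shift-left : (shift (alt (transform a)) ⋆ transform b) n ≈ P (shift a) b - P a b
    shift-left = trans (⋆-congˡ (alt-transform-suc a) (transform b) n)
                       (⋆-distribʳ-- (alt (transform (shift a))) (alt (transform a)) (transform b) n)

    shift-alt : (a ⋆ shift (alt b)) n ≈ - (a ⋆ alt (shift b)) n
    shift-alt = trans (⋆-congʳ a (alt-suc b) n) (⋆-negʳ a (alt (shift b)) n)

theorem28 : {c ℓ : Level} (R : CommutativeRing c ℓ) →
    let open CommutativeRing R in
    (s σ t τ : ℕ → Carrier) →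
    IsBinomialPair R s σ → IsBinomialPair R t τ →
    (n : ℕ) →
    ∑1 R n (λ k → (- neg1^ R (n ∸ k)) * (binom R n k * (s (k ∸ 1) * t (n ∸ k))))
      ≈ ∑1 R n (λ k → neg1^ R k * (binom R n k * (τ (n ∸ k) * ∑1 R k (λ j → σ (j ∸ 1)))))
theorem28 R s σ t τ σ-pair τ-pair n = begin
  ∑1 R n (λ k → (- neg1^ R (n ∸ k)) * (binom R n k * (s (k ∸ 1) * t (n ∸ k))))
    ≈⟨ ∑1-cong n (λ k → -x*[w*[y*z]]≈w*[-y*[x*z]] _ _ _ _) ⟩
  ∑1 R n (λ k → binom R n k * (u k * alt t (n ∸ k)))
    ≈⟨ ⋆≈∑1 (alt t) n refl ⟨
  (u ⋆ alt t) n
    ≈⟨ alt-transform-⋆-transform n u t ⟨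
  (alt (transform u) ⋆ transform t) n
    ≈⟨ ⋆≈∑1 (transform t) n (trans (*-identityˡ _) (transform-0 u)) ⟩
  ∑1 R n (λ k → binom R n k * (alt (transform u) k * transform t (n ∸ k)))
    ≈⟨ ∑1-cong n (λ k → summand (suc k)) ⟩
  ∑1 R n (λ k → neg1^ R k * (binom R n k * (τ (n ∸ k) * ∑1 R k (λ j → σ (j ∸ 1)))))
    ∎
  where
  open CommutativeRing R
  open BinomialConvolution R
  open SetoidReasoning setoid

  u : Seq
  u = 0# ∷ λ j → - s j

  transform-u : ∀ k → transform u k ≈ ∑1 R k (λ j → σ (j ∸ 1))
  transform-u k = trans (transform-partialSums s k)
                        (∑1-cong k (λ j → sym (IsBinomialPair⇒≈transform σ-pair j)))

  summand : ∀ k → binom R n k * (alt (transform u) k * transform t (n ∸ k))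
                ≈ neg1^ R k * (binom R n k * (τ (n ∸ k) * ∑1 R k (λ j → σ (j ∸ 1))))
  summand k = trans (*-congˡ (*-cong (*-congˡ (transform-u k))
                                     (sym (IsBinomialPair⇒≈transform τ-pair (n ∸ k)))))
                    (w*[xy*z]≈x*[w*[zy]] _ _ _ _)
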